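{- Let $k\ge 1$ and let $B_1,\dots,B_k$ be complete bipartite graphs forming an odd cover of $K_{2k}$, where $B_i$ has parts $X_i$ and $Y_i$. Then: (i) if $k$ is odd, then $|X_i|\equiv|Y_i|\equiv 1\pmod 4$ for all $1\le i\le k$; if $k$ is even, then $|X_i|\equiv|Y_i|\equiv 3\pmod 4$ for all $1\le i\le k$; (ii) for all $i\ne j$ in $\{1,\ldots,k\}$, the numbers $|X_i\cap X_j|$, $|X_i\cap Y_j|$ and $|Y_i\cap Y_j|$ are all odd; (iii) with $U_i=X_i\cup Y_i$, every vertex of $K_{2k}$ lies in an odd number of the sets $U_1,\dots,U_k$; (iv) for every integer $s\equiv 2$ or $3\pmod 4$ and every set $A\subseteq V(K_{2k})$ with $|A|=s$, there is an $i$ such that $|A\cap X_i|$ and $|A\cap Y_i|$ are both odd.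
   Context: $K_{2k}$ is the complete graph on $2k$ vertices. An odd cover of a graph $G$ is a collection of complete bipartite graphs with disjoint parts $(X,Y)$, $X,Y\subseteq V(G)$, such that each edge of $G$ is covered (one endpoint in $X$, the other in $Y$) by an odd number of them and each nonedge by an even number. (An odd cover of $K_{2k}$ with $k$ bicliques is a perfect odd cover.) -}

module Defs where

open import Data.Nat using (ℕ; _*_; _%_)
open import Data.Bool using (Bool; _∧_; _∨_)
open import Data.Product using (_×_)
open import Data.Fin using (Fin)
open import Data.Fin.Subset using (Subset; _∩_; ∣_∣; ⊥)
open import Data.Vec using (lookup; tabulate)
open import Relation.Binary.PropositionalEquality using (_≡_; _≢_)

Odd : ℕ → Set
Odd n = n % 2 ≡ 1

-- Vertex set of K_{2k} is Fin (2 * k); a family of k bicliques is given by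
-- parts X i , Y i : Subset (2 * k) for i : Fin k.

covers : ∀ {n} → Subset n → Subset n → Fin n → Fin n → Bool
covers X Y u v = (lookup X u ∧ lookup Y v) ∨ (lookup Y u ∧ lookup X v)

coverCount : ∀ {n k} → (Fin k → Subset n) → (Fin k → Subset n) → Fin n → Fin n → ℕ
coverCount X Y u v = ∣ tabulate (λ i → covers (X i) (Y i) u v) ∣

-- Odd cover of the complete graph K_n by the family (X i, Y i):
-- parts disjoint, every edge (pair of distinct vertices) covered an odd
-- number of times (K_n has no nonedges).
IsOddCoverOfComplete : ∀ {n k} → (Fin k → Subset n) → (Fin k → Subset n) → Set
IsOddCoverOfComplete {n} {k} X Y =
  ((i : Fin k) → X i ∩ Y i ≡ ⊥) × ((u v : Fin n) → u ≢ v → Odd (coverCount X Y u v))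

-- Work over 𝔽₂ = Bool, with xᵢ, yᵢ the indicator vectors of Xᵢ, Yᵢ. The odd cover
-- says ∑ᵢ (xᵢ yᵢᵀ + yᵢ xᵢᵀ) = J + I, the adjacency matrix of K₂ₖ, and J + I is an
-- involution because 2k is even. So the 2k × 2k matrix P with columns x₁ … xₖ,
-- y₁ … yₖ has the right inverse Ω Pᵀ (J + I), where Ω swaps xᵢ and yᵢ. By counting
-- (an injective self-map of 𝔽₂²ᵏ is onto) this is also a left inverse, that is
-- Pᵀ (J + I) P = Ω: the xᵢ, yᵢ form a symplectic basis for the form
-- β(a, b) = aᵀ (J + I) b = (∑ a)(∑ b) + ⟨a, b⟩. Its entries give |Xᵢ|, |Yᵢ| odd
-- and (ii), and P𝟙 = 𝟙 gives (iii). For (i) and (iv) count the edges inside a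
-- vertex set A modulo 2: there are (|A| choose 2) ≡ ⌊|A|/2⌋ of them, and the
-- cover splits them as ∑ᵢ |A ∩ Xᵢ| |A ∩ Yᵢ|, which for A = Xᵢ is k − 1 by (ii).

module Submission where

open import Defs
open import Data.Nat using (ℕ; _*_; _%_; _≤_)
open import Data.Bool using (Bool)
open import Data.Fin using (Fin)
open import Data.Fin.Subset using (Subset; _∩_; _∪_; ∣_∣)
open import Data.Vec using (lookup; tabulate)
open import Data.Product using (_×_; ∃-syntax)
open import Data.Sum using (_⊎_)
open import Relation.Binary.PropositionalEquality using (_≡_; _≢_)

open import Algebra.Bundles using (CommutativeRing; CommutativeMonoid)
open import Data.Bool using (true; false; not; _∧_; _∨_; _xor_; if_then_else_)
open import Data.Bool.Properties
  using ( xor-∧-commutativeRing; ∧-commutativeMonoid; true-xor; xor-same; xor-comm; xor-assoc; xor-identityʳ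
        ; not-involutive; not-distribʳ-xor; ∧-distribˡ-xor; ∧-distribʳ-xor; ∧-zeroʳ; ∧-identityʳ; ∧-comm; xor-is-ok )
open import Data.Fin using (zero; suc; punchOut; funToFin; finToFun; combine)
open import Data.Fin.Properties
  using ( _≟_; suc-injective; any?; punchOut-injective; injective⇒≤; 2↔Bool; +↔⊎
        ; funToFin-finToFin; finToFun-funToFin )
open import Data.Fin.Subset using (⊥)
open import Data.Maybe using (Maybe; just; nothing)
open import Data.Nat using (zero; suc; _+_; _^_; ⌊_/2⌋)
open import Data.Nat.Properties using (+-identityʳ; 1+n≰n)
open import Data.Product using (∃; _,_; proj₁; proj₂)
open import Data.Sum using (inj₁; inj₂; [_,_]′; swap)
open import Data.Sum.Properties using (≡-dec)
open import Data.Vec using (_∷_; [])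
open import Data.Vec.Properties using (lookup-zipWith; lookup-replicate; lookup∘tabulate)
open import Function using (_∘_; Inverse; _↔_)
open import Function.Definitions using (Injective)
open import Relation.Binary.PropositionalEquality using (_≗_; refl; sym; trans; cong; cong₂; subst; module ≡-Reasoning)
open import Relation.Nullary using (does; yes; no; contradiction)
open import Relation.Nullary.Decidable using (dec-true; dec-false)
open import Tactic.RingSolver using (solve-∀)
open import Tactic.RingSolver.Core.AlmostCommutativeRing using (AlmostCommutativeRing; fromCommutativeRing)
open import Algebra.Properties.Semiring.Sum (CommutativeRing.semiring xor-∧-commutativeRing)
  using (sum; sum-syntax; sum-cong-≗; sum-replicate-zero; ∑-distrib-+; ∑-comm; *-distribˡ-sum; *-distribʳ-sum)
open import Algebra.Properties.CommutativeSemigroup (CommutativeMonoid.commutativeSemigroup ∧-commutativeMonoid)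
  using () renaming (interchange to ∧-interchange)

private variable m n k : ℕ

𝔽₂ : AlmostCommutativeRing _ _
𝔽₂ = fromCommutativeRing xor-∧-commutativeRing false≟
  where
  false≟ : (b : Bool) → Maybe (false ≡ b)
  false≟ false = just refl
  false≟ true  = nothing

∧≡true : ∀ {p q} → p ∧ q ≡ true → p ≡ true × q ≡ true
∧≡true {true} {true} _ = refl , refl

∨≡xor : ∀ p q → p ∧ q ≡ false → p ∨ q ≡ p xor q
∨≡xor p q p∧q≡false = sym (begin
  p xor q                    ≡⟨ xor-is-ok p q ⟩
  (p ∨ q) ∧ not (p ∧ q)      ≡⟨ cong (λ b → (p ∨ q) ∧ not b) p∧q≡false ⟩
  (p ∨ q) ∧ true             ≡⟨ ∧-identityʳ (p ∨ q) ⟩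
  p ∨ q                      ∎)
  where open ≡-Reasoning

oddᵇ : ℕ → Bool
oddᵇ zero          = false
oddᵇ (suc zero)    = true
oddᵇ (suc (suc n)) = oddᵇ n

oddᵇ-suc : ∀ n → oddᵇ (suc n) ≡ not (oddᵇ n)
oddᵇ-suc zero          = refl
oddᵇ-suc (suc zero)    = refl
oddᵇ-suc (suc (suc n)) = oddᵇ-suc n

oddᵇ-+ : ∀ m n → oddᵇ (m + n) ≡ oddᵇ m xor oddᵇ n
oddᵇ-+ zero          n = refl
oddᵇ-+ (suc zero)    n = trans (oddᵇ-suc n) (sym (true-xor (oddᵇ n)))
oddᵇ-+ (suc (suc m)) n = oddᵇ-+ m n

oddᵇ-2* : ∀ k → oddᵇ (2 * k) ≡ false
oddᵇ-2* k = begin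
  oddᵇ (k + (k + 0))         ≡⟨ cong (λ m → oddᵇ (k + m)) (+-identityʳ k) ⟩
  oddᵇ (k + k)               ≡⟨ oddᵇ-+ k k ⟩
  oddᵇ k xor oddᵇ k          ≡⟨ xor-same (oddᵇ k) ⟩
  false                      ∎
  where open ≡-Reasoning

Odd⇒oddᵇ : ∀ n → Odd n → oddᵇ n ≡ true
Odd⇒oddᵇ (suc zero)    _   = refl
Odd⇒oddᵇ (suc (suc n)) odd = Odd⇒oddᵇ n odd

oddᵇ⇒Odd : ∀ n → oddᵇ n ≡ true → Odd n
oddᵇ⇒Odd (suc zero)    _   = refl
oddᵇ⇒Odd (suc (suc n)) odd = oddᵇ⇒Odd n odd

%2≡0⇒oddᵇ≡false : ∀ n → n % 2 ≡ 0 → oddᵇ n ≡ false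
%2≡0⇒oddᵇ≡false zero          _    = refl
%2≡0⇒oddᵇ≡false (suc (suc n)) even = %2≡0⇒oddᵇ≡false n even

-- oddᵇ ⌊ m /2⌋ is the parity of the binomial coefficient (m choose 2).
oddᵇ-⌊suc/2⌋ : ∀ m → oddᵇ ⌊ suc m /2⌋ ≡ oddᵇ m xor oddᵇ ⌊ m /2⌋
oddᵇ-⌊suc/2⌋ zero          = refl
oddᵇ-⌊suc/2⌋ (suc zero)    = refl
oddᵇ-⌊suc/2⌋ (suc (suc m)) = begin
  oddᵇ (suc ⌊ suc m /2⌋)            ≡⟨ oddᵇ-suc ⌊ suc m /2⌋ ⟩
  not (oddᵇ ⌊ suc m /2⌋)            ≡⟨ cong not (oddᵇ-⌊suc/2⌋ m) ⟩
  not (oddᵇ m xor oddᵇ ⌊ m /2⌋)     ≡⟨ not-distribʳ-xor (oddᵇ m) _ ⟩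
  oddᵇ m xor not (oddᵇ ⌊ m /2⌋)     ≡⟨ cong (oddᵇ m xor_) (oddᵇ-suc ⌊ m /2⌋) ⟨
  oddᵇ m xor oddᵇ (suc ⌊ m /2⌋)     ∎
  where open ≡-Reasoning

oddᵇ⇒%4 : ∀ m → oddᵇ m ≡ true → m % 4 ≡ (if oddᵇ ⌊ m /2⌋ then 3 else 1)
oddᵇ⇒%4 (suc zero)                      _   = refl
oddᵇ⇒%4 (suc (suc (suc zero)))          _   = refl
oddᵇ⇒%4 (suc (suc (suc (suc m))))       odd = oddᵇ⇒%4 m odd

%4≡2∨3⇒oddᵇ⌊/2⌋ : ∀ m → m % 4 ≡ 2 ⊎ m % 4 ≡ 3 → oddᵇ ⌊ m /2⌋ ≡ true
%4≡2∨3⇒oddᵇ⌊/2⌋ (suc (suc zero))          _ = refl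
%4≡2∨3⇒oddᵇ⌊/2⌋ (suc (suc (suc zero)))    _ = refl
%4≡2∨3⇒oddᵇ⌊/2⌋ (suc (suc (suc (suc m)))) r = %4≡2∨3⇒oddᵇ⌊/2⌋ m r
%4≡2∨3⇒oddᵇ⌊/2⌋ zero       (inj₁ ())
%4≡2∨3⇒oddᵇ⌊/2⌋ zero       (inj₂ ())
%4≡2∨3⇒oddᵇ⌊/2⌋ (suc zero) (inj₁ ())
%4≡2∨3⇒oddᵇ⌊/2⌋ (suc zero) (inj₂ ())

∑-lookup : (p : Subset n) → sum (lookup p) ≡ oddᵇ ∣ p ∣
∑-lookup []          = refl
∑-lookup (true ∷ p)  = trans (cong not (∑-lookup p)) (sym (oddᵇ-suc ∣ p ∣))
∑-lookup (false ∷ p) = ∑-lookup p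

∑-const : ∀ n b → ∑[ _ < n ] b ≡ oddᵇ n ∧ b
∑-const zero    b = refl
∑-const (suc n) b = begin
  b xor ∑[ _ < n ] b           ≡⟨ cong (b xor_) (∑-const n b) ⟩
  b xor (oddᵇ n ∧ b)           ≡⟨ ∧-distribʳ-xor b true (oddᵇ n) ⟨
  (true xor oddᵇ n) ∧ b        ≡⟨ cong (_∧ b) (trans (true-xor (oddᵇ n)) (sym (oddᵇ-suc n))) ⟩
  oddᵇ (suc n) ∧ b             ∎
  where open ≡-Reasoning

∑-δ : (u : Fin n) (z : Fin n → Bool) → ∑[ v < n ] (does (u ≟ v) ∧ z v) ≡ z u
∑-δ {suc n} zero    z = trans (cong (z zero xor_) (sum-replicate-zero n)) (xor-identityʳ (z zero))
∑-δ {suc n} (suc u) z = ∑-δ u (z ∘ suc)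

∑≡true⇒∃ : (f : Fin n → Bool) → sum f ≡ true → ∃ λ i → f i ≡ true
∑≡true⇒∃ {suc n} f ∑f≡true with f zero in f₀≡
... | true  = zero , f₀≡
... | false = let i , fi≡true = ∑≡true⇒∃ (f ∘ suc) ∑f≡true in suc i , fi≡true

⟨_,_⟩ : (Fin n → Bool) → (Fin n → Bool) → Bool
⟨ a , b ⟩ = sum (λ u → a u ∧ b u)

-- The adjacency matrix J − I of the complete graph, which over 𝔽₂ is J + I.
adjK : (Fin n → Bool) → Fin n → Bool
adjK z u = sum z xor z u

β : (Fin n → Bool) → (Fin n → Bool) → Bool
β a b = (sum a ∧ sum b) xor ⟨ a , b ⟩

∑-offDiagonal : (u : Fin n) (z : Fin n → Bool) → ∑[ v < n ] (not (does (u ≟ v)) ∧ z v) ≡ adjK z u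
∑-offDiagonal u z = begin
  ∑[ v < _ ] (not (does (u ≟ v)) ∧ z v)                ≡⟨ sum-cong-≗ split ⟩
  ∑[ v < _ ] (z v xor does (u ≟ v) ∧ z v)              ≡⟨ ∑-distrib-+ z _ ⟩
  sum z xor ∑[ v < _ ] (does (u ≟ v) ∧ z v)            ≡⟨ cong (sum z xor_) (∑-δ u z) ⟩
  sum z xor z u                                        ∎
  where
  open ≡-Reasoning
  split : ∀ v → not (does (u ≟ v)) ∧ z v ≡ z v xor does (u ≟ v) ∧ z v
  split v = trans (cong (_∧ z v) (sym (true-xor _))) (∧-distribʳ-xor (z v) true _)

≟-sym : (i j : Fin n) → does (i ≟ j) ≡ does (j ≟ i)
≟-sym zero    zero    = refl
≟-sym zero    (suc j) = refl
≟-sym (suc i) zero    = refl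
≟-sym (suc i) (suc j) = ≟-sym i j

∑-≢ : (i : Fin k) → ∑[ j < k ] not (does (j ≟ i)) ≡ not (oddᵇ k)
∑-≢ {k} i = begin
  ∑[ j < k ] not (does (j ≟ i))              ≡⟨ sum-cong-≗ (λ j → trans (cong not (≟-sym j i)) (sym (∧-identityʳ _))) ⟩
  ∑[ j < k ] (not (does (i ≟ j)) ∧ true)     ≡⟨ ∑-offDiagonal i (λ _ → true) ⟩
  ∑[ _ < k ] true xor true                   ≡⟨ cong (_xor true) (trans (∑-const k true) (∧-identityʳ (oddᵇ k))) ⟩
  oddᵇ k xor true                            ≡⟨ trans (xor-comm (oddᵇ k) true) (true-xor (oddᵇ k)) ⟩
  not (oddᵇ k)                               ∎
  where open ≡-Reasoning

β≡⟨-,adjK-⟩ : (a b : Fin n → Bool) → β a b ≡ ⟨ a , adjK b ⟩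
β≡⟨-,adjK-⟩ {n} a b = begin
  (sum a ∧ sum b) xor ⟨ a , b ⟩                         ≡⟨ cong (_xor ⟨ a , b ⟩) (*-distribʳ-sum (sum b) a) ⟩
  ∑[ u < n ] (a u ∧ sum b) xor ⟨ a , b ⟩                ≡⟨ ∑-distrib-+ (λ u → a u ∧ sum b) (λ u → a u ∧ b u) ⟨
  ∑[ u < n ] ((a u ∧ sum b) xor (a u ∧ b u))            ≡⟨ sum-cong-≗ (λ u → ∧-distribˡ-xor (a u) (sum b) (b u)) ⟨
  ⟨ a , adjK b ⟩                                        ∎
  where open ≡-Reasoning

adjK-involutive : oddᵇ n ≡ false → (z : Fin n → Bool) → ∀ u → adjK (adjK z) u ≡ z u
adjK-involutive {n} even z u = begin
  sum (adjK z) xor adjK z u                              ≡⟨ cong (_xor adjK z u) ∑adjK ⟩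
  sum z xor (sum z xor z u)                              ≡⟨ xor-assoc (sum z) (sum z) (z u) ⟨
  (sum z xor sum z) xor z u                              ≡⟨ cong (_xor z u) (xor-same (sum z)) ⟩
  z u                                                    ∎
  where
  open ≡-Reasoning
  ∑adjK : sum (adjK z) ≡ sum z
  ∑adjK = begin
    ∑[ v < n ] (sum z xor z v)                ≡⟨ ∑-distrib-+ _ z ⟩
    ∑[ _ < n ] sum z xor sum z                ≡⟨ cong (_xor sum z) (trans (∑-const n (sum z)) (cong (_∧ sum z) even)) ⟩
    sum z                                     ∎

β-congʳ : (a : Fin n → Bool) {b b′ : Fin n → Bool} → b ≗ b′ → β a b ≡ β a b′
β-congʳ a b≗b′ = cong₂ (λ s p → (sum a ∧ s) xor p) (sum-cong-≗ b≗b′) (sum-cong-≗ (cong (a _ ∧_) ∘ b≗b′))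

β-ones : oddᵇ n ≡ false → (a : Fin n → Bool) → β a (λ _ → true) ≡ sum a
β-ones {n} even a = begin
  (sum a ∧ ∑[ _ < n ] true) xor ⟨ a , (λ _ → true) ⟩   ≡⟨ cong₂ (λ s p → (sum a ∧ s) xor p) ∑ones≡false ⟨a,ones⟩≡∑a ⟩
  (sum a ∧ false) xor sum a                            ≡⟨ cong (_xor sum a) (∧-zeroʳ (sum a)) ⟩
  sum a                                                ∎
  where
  open ≡-Reasoning
  ∑ones≡false : ∑[ _ < n ] true ≡ false
  ∑ones≡false = trans (∑-const n true) (cong (_∧ true) even)
  ⟨a,ones⟩≡∑a : ⟨ a , (λ _ → true) ⟩ ≡ sum a
  ⟨a,ones⟩≡∑a = sum-cong-≗ (∧-identityʳ ∘ a)

⟨⟩≡not-β : {a b : Fin n → Bool} → sum a ≡ true → sum b ≡ true → ⟨ a , b ⟩ ≡ not (β a b)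
⟨⟩≡not-β {a = a} {b} ∑a≡true ∑b≡true rewrite ∑a≡true | ∑b≡true = sym (not-involutive ⟨ a , b ⟩)

pairSum : (Fin n → Fin n → Bool) → Bool
pairSum {zero}  f = false
pairSum {suc n} f = ∑[ v < n ] f zero (suc v) xor pairSum (λ u v → f (suc u) (suc v))

pairSum-cong : {f g : Fin n → Fin n → Bool} → (∀ u v → u ≢ v → f u v ≡ g u v) → pairSum f ≡ pairSum g
pairSum-cong {zero}  f≡g = refl
pairSum-cong {suc n} f≡g = cong₂ _xor_
  (sum-cong-≗ (λ v → f≡g zero (suc v) (λ ())))
  (pairSum-cong (λ u v u≢v → f≡g (suc u) (suc v) (u≢v ∘ suc-injective)))

pairSum-∑ : (G : Fin k → Fin n → Fin n → Bool) → pairSum (λ u v → ∑[ i < k ] G i u v) ≡ ∑[ i < k ] pairSum (G i)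
pairSum-∑ {k} {zero}  G = sym (sum-replicate-zero k)
pairSum-∑ {k} {suc n} G = begin
  ∑[ v < n ] ∑[ i < k ] G i zero (suc v) xor pairSum (λ u v → ∑[ i < k ] G i (suc u) (suc v))
    ≡⟨ cong₂ _xor_ (∑-comm (λ v i → G i zero (suc v))) (pairSum-∑ (λ i u v → G i (suc u) (suc v))) ⟩
  ∑[ i < k ] ∑[ v < n ] G i zero (suc v) xor ∑[ i < k ] pairSum (λ u v → G i (suc u) (suc v))
    ≡⟨ ∑-distrib-+ (λ i → ∑[ v < n ] G i zero (suc v)) (λ i → pairSum (λ u v → G i (suc u) (suc v))) ⟨
  ∑[ i < k ] pairSum (G i)
    ∎
  where open ≡-Reasoning

pairSum-symmetrized : (a b : Fin n → Bool) → pairSum (λ u v → a u ∧ b v xor b u ∧ a v) ≡ β a b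
pairSum-symmetrized {zero}  a b = refl
pairSum-symmetrized {suc n} a b = begin
  ∑[ v < n ] (a₀ ∧ b (suc v) xor b₀ ∧ a (suc v)) xor pairSum (λ u v → a (suc u) ∧ b (suc v) xor b (suc u) ∧ a (suc v))
    ≡⟨ cong₂ _xor_ heads (pairSum-symmetrized (a ∘ suc) (b ∘ suc)) ⟩
  (a₀ ∧ ∑b xor b₀ ∧ ∑a) xor ((∑a ∧ ∑b) xor ⟨ a ∘ suc , b ∘ suc ⟩)
    ≡⟨ expand a₀ b₀ ∑a ∑b ⟨ a ∘ suc , b ∘ suc ⟩ ⟩
  β a b
    ∎
  where
  open ≡-Reasoning
  a₀ = a zero
  b₀ = b zero
  ∑a = sum (a ∘ suc)
  ∑b = sum (b ∘ suc)
  heads : ∑[ v < n ] (a₀ ∧ b (suc v) xor b₀ ∧ a (suc v)) ≡ a₀ ∧ ∑b xor b₀ ∧ ∑a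
  heads = trans (∑-distrib-+ (λ v → a₀ ∧ b (suc v)) (λ v → b₀ ∧ a (suc v)))
                (sym (cong₂ _xor_ (*-distribˡ-sum a₀ (b ∘ suc)) (*-distribˡ-sum b₀ (a ∘ suc))))
  expand : ∀ a₀ b₀ A B P → (a₀ ∧ B xor b₀ ∧ A) xor ((A ∧ B) xor P) ≡ ((a₀ xor A) ∧ (b₀ xor B)) xor ((a₀ ∧ b₀) xor P)
  expand = solve-∀ 𝔽₂

pairSum-square : (p : Subset n) → pairSum (λ u v → lookup p u ∧ lookup p v) ≡ oddᵇ ⌊ ∣ p ∣ /2⌋
pairSum-square []          = refl
pairSum-square (true ∷ p)  = trans (cong₂ _xor_ (∑-lookup p) (pairSum-square p)) (sym (oddᵇ-⌊suc/2⌋ ∣ p ∣))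
pairSum-square {suc n} (false ∷ p) = cong₂ _xor_ (sum-replicate-zero n) (pairSum-square p)

injective⇒surjective : (f : Fin m → Fin m) → Injective _≡_ _≡_ f → ∀ j → ∃ λ i → f i ≡ j
injective⇒surjective {suc m} f f-injective j with any? (λ i → f i ≟ j)
... | yes hit = hit
... | no miss = contradiction (injective⇒≤ punched-injective) 1+n≰n
  where
  j≢f : ∀ i → j ≢ f i
  j≢f i j≡fi = miss (i , sym j≡fi)
  punched-injective : Injective _≡_ _≡_ (λ i → punchOut (j≢f i))
  punched-injective = f-injective ∘ punchOut-injective (j≢f _) (j≢f _)

funToFin-cong : {f g : Fin m → Fin n} → f ≗ g → funToFin f ≡ funToFin g
funToFin-cong {zero}  f≗g = refl
funToFin-cong {suc m} f≗g = cong₂ combine (f≗g zero) (funToFin-cong (f≗g ∘ suc))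

encode : (Fin n → Bool) → Fin (2 ^ n)
encode a = funToFin (Inverse.from 2↔Bool ∘ a)

decode : Fin (2 ^ n) → Fin n → Bool
decode {n} i = Inverse.to 2↔Bool ∘ finToFun {2} {n} i

decode-encode : (a : Fin n → Bool) → decode (encode a) ≗ a
decode-encode {n} a u =
  trans (cong (Inverse.to 2↔Bool) (finToFun-funToFin {n} _ u)) (Inverse.strictlyInverseˡ 2↔Bool (a u))

decode-injective : {i j : Fin (2 ^ n)} → decode i ≗ decode j → i ≡ j
decode-injective {n} {i} {j} i≗j = begin
  i                              ≡⟨ funToFin-finToFin {n} i ⟨
  funToFin (finToFun {2} {n} i)  ≡⟨ funToFin-cong bits ⟩
  funToFin (finToFun {2} {n} j)  ≡⟨ funToFin-finToFin {n} j ⟩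
  j                              ∎
  where
  open ≡-Reasoning
  open Inverse 2↔Bool using (from; strictlyInverseʳ)
  bits : finToFun {2} {n} i ≗ finToFun j
  bits u = trans (sym (strictlyInverseʳ _)) (trans (cong from (i≗j u)) (strictlyInverseʳ _))

encode-injective : {a b : Fin n → Bool} → encode a ≡ encode b → a ≗ b
encode-injective {a = a} {b} ea≡eb u =
  trans (sym (decode-encode a u)) (trans (cong (λ i → decode i u) ea≡eb) (decode-encode b u))

𝔽₂-injective⇒surjective : {C : Set} → Fin n ↔ C → (f : (Fin n → Bool) → C → Bool) →
  (∀ {a b} → f a ≗ f b → a ≗ b) → ∀ t → ∃ λ a → f a ≗ t
𝔽₂-injective⇒surjective {n} {C} C↔ f f-injective t =
  let i , gi≡t = injective⇒surjective g g-injective (encode (t ∘ to))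
  in decode {n} i , via-to (encode-injective gi≡t)
  where
  open Inverse C↔ using (to; from; strictlyInverseˡ)
  via-to : {h h′ : C → Bool} → h ∘ to ≗ h′ ∘ to → h ≗ h′
  via-to {h} {h′} eq c =
    trans (cong h (sym (strictlyInverseˡ c))) (trans (eq (from c)) (cong h′ (strictlyInverseˡ c)))
  g : Fin (2 ^ n) → Fin (2 ^ n)
  g i = encode (f (decode {n} i) ∘ to)
  g-injective : Injective _≡_ _≡_ g
  g-injective = decode-injective ∘ f-injective ∘ via-to ∘ encode-injective

disjoint-lookup : {p q : Subset n} → p ∩ q ≡ ⊥ → ∀ u → lookup p u ∧ lookup q u ≡ false
disjoint-lookup {p = p} {q} p∩q≡⊥ u =
  trans (sym (lookup-zipWith _∧_ u p q)) (trans (cong (λ r → lookup r u) p∩q≡⊥) (lookup-replicate u false))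

∣∩∣-parity : (p q : Subset n) → oddᵇ ∣ p ∩ q ∣ ≡ ⟨ lookup p , lookup q ⟩
∣∩∣-parity p q = trans (sym (∑-lookup (p ∩ q))) (sum-cong-≗ (λ u → lookup-zipWith _∧_ u p q))

⟨⟩≡true⇒Odd∣∩∣ : (p q : Subset n) → ⟨ lookup p , lookup q ⟩ ≡ true → Odd ∣ p ∩ q ∣
⟨⟩≡true⇒Odd∣∩∣ p q ⟨p,q⟩≡true = oddᵇ⇒Odd ∣ p ∩ q ∣ (trans (∣∩∣-parity p q) ⟨p,q⟩≡true)

CoverEquation : (x y : Fin k → Fin n → Bool) → Set
CoverEquation {k} x y = ∀ u v → ∑[ i < k ] (x i u ∧ y i v xor y i u ∧ x i v) ≡ not (does (u ≟ v))

oddCover⇒coverEquation : {X Y : Fin k → Subset n} → IsOddCoverOfComplete X Y → CoverEquation (lookup ∘ X) (lookup ∘ Y)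
oddCover⇒coverEquation {k} {n} {X} {Y} (disjoint , odd) u v with u ≟ v
... | yes refl = trans (sum-cong-≗ diagonal) (sum-replicate-zero k)
  where
  diagonal : ∀ i → lookup (X i) u ∧ lookup (Y i) u xor lookup (Y i) u ∧ lookup (X i) u ≡ false
  diagonal i = cong₂ _xor_ (disjoint-lookup (disjoint i) u)
                           (trans (∧-comm (lookup (Y i) u) _) (disjoint-lookup (disjoint i) u))
... | no u≢v = begin
  ∑[ i < k ] (x i u ∧ y i v xor y i u ∧ x i v)
    ≡⟨ sum-cong-≗ covers≡xor ⟨
  ∑[ i < k ] covers (X i) (Y i) u v
    ≡⟨ sum-cong-≗ (lookup∘tabulate (λ i → covers (X i) (Y i) u v)) ⟨
  sum (lookup (tabulate (λ i → covers (X i) (Y i) u v)))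
    ≡⟨ ∑-lookup (tabulate (λ i → covers (X i) (Y i) u v)) ⟩
  oddᵇ (coverCount X Y u v)
    ≡⟨ Odd⇒oddᵇ (coverCount X Y u v) (odd u v u≢v) ⟩
  true
    ∎
  where
  open ≡-Reasoning
  x y : Fin k → Fin n → Bool
  x = lookup ∘ X
  y = lookup ∘ Y
  covers≡xor : ∀ i → covers (X i) (Y i) u v ≡ x i u ∧ y i v xor y i u ∧ x i v
  covers≡xor i = ∨≡xor (x i u ∧ y i v) (y i u ∧ x i v)
    (trans (∧-interchange (x i u) (y i v) (y i u) (x i v))
           (cong (_∧ (y i v ∧ x i v)) (disjoint-lookup (disjoint i) u)))

pairSum≡∑products : {x y : Fin k → Fin n → Bool} → CoverEquation x y → (∀ i u → x i u ∧ y i u ≡ false) →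
  (a : Fin n → Bool) → pairSum (λ u v → a u ∧ a v) ≡ ∑[ i < k ] (⟨ a , x i ⟩ ∧ ⟨ a , y i ⟩)
pairSum≡∑products {k} {n} {x} {y} cover disjoint a = begin
  pairSum (λ u v → a u ∧ a v)
    ≡⟨ pairSum-cong through-cover ⟩
  pairSum (λ u v → ∑[ i < k ] (ax i u ∧ ay i v xor ay i u ∧ ax i v))
    ≡⟨ pairSum-∑ (λ i u v → ax i u ∧ ay i v xor ay i u ∧ ax i v) ⟩
  ∑[ i < k ] pairSum (λ u v → ax i u ∧ ay i v xor ay i u ∧ ax i v)
    ≡⟨ sum-cong-≗ (λ i → pairSum-symmetrized (ax i) (ay i)) ⟩
  ∑[ i < k ] ((⟨ a , x i ⟩ ∧ ⟨ a , y i ⟩) xor ⟨ ax i , ay i ⟩)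
    ≡⟨ sum-cong-≗ (λ i → trans (cong ((⟨ a , x i ⟩ ∧ ⟨ a , y i ⟩) xor_) (restricted-disjoint i)) (xor-identityʳ _)) ⟩
  ∑[ i < k ] (⟨ a , x i ⟩ ∧ ⟨ a , y i ⟩)
    ∎
  where
  open ≡-Reasoning
  ax ay : Fin k → Fin n → Bool
  ax i u = a u ∧ x i u
  ay i u = a u ∧ y i u
  restricted-disjoint : ∀ i → ⟨ ax i , ay i ⟩ ≡ false
  restricted-disjoint i = trans (sum-cong-≗ vanishes) (sum-replicate-zero n)
    where
    vanishes : ∀ u → (a u ∧ x i u) ∧ (a u ∧ y i u) ≡ false
    vanishes u = trans (∧-interchange (a u) (x i u) (a u) (y i u))
                       (trans (cong ((a u ∧ a u) ∧_) (disjoint i u)) (∧-zeroʳ (a u ∧ a u)))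
  through-cover : ∀ u v → u ≢ v → a u ∧ a v ≡ ∑[ i < k ] (ax i u ∧ ay i v xor ay i u ∧ ax i v)
  through-cover u v u≢v = begin
    a u ∧ a v
      ≡⟨ ∧-identityʳ (a u ∧ a v) ⟨
    (a u ∧ a v) ∧ true
      ≡⟨ cong (λ b → (a u ∧ a v) ∧ not b) (dec-false (u ≟ v) u≢v) ⟨
    (a u ∧ a v) ∧ not (does (u ≟ v))
      ≡⟨ cong ((a u ∧ a v) ∧_) (cover u v) ⟨
    (a u ∧ a v) ∧ ∑[ i < k ] (x i u ∧ y i v xor y i u ∧ x i v)
      ≡⟨ *-distribˡ-sum (a u ∧ a v) (λ i → x i u ∧ y i v xor y i u ∧ x i v) ⟩
    ∑[ i < k ] ((a u ∧ a v) ∧ (x i u ∧ y i v xor y i u ∧ x i v))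
      ≡⟨ sum-cong-≗ (λ i → distribute (a u) (a v) (x i u) (y i v) (y i u) (x i v)) ⟩
    ∑[ i < k ] (ax i u ∧ ay i v xor ay i u ∧ ax i v)
      ∎
    where
    distribute : ∀ p q r s t w → (p ∧ q) ∧ (r ∧ s xor t ∧ w) ≡ (p ∧ r) ∧ (q ∧ s) xor (p ∧ t) ∧ (q ∧ w)
    distribute = solve-∀ 𝔽₂

Fin2k↔⊎ : ∀ k → Fin (2 * k) ↔ (Fin k ⊎ Fin k)
Fin2k↔⊎ k = subst (λ m → Fin (2 * k) ↔ (Fin k ⊎ Fin m)) (+-identityʳ k) +↔⊎

module SymplecticBasis {k} (x y : Fin k → Fin (2 * k) → Bool) (cover : CoverEquation x y) where

  Index : Set
  Index = Fin k ⊎ Fin k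

  column : Index → Fin (2 * k) → Bool
  column = [ x , y ]′

  unit : Index → Index → Bool
  unit c c′ = does (≡-dec _≟_ _≟_ c c′)

  -- synthesis is the matrix P with columns xᵢ, yᵢ, and analysis is Ω Pᵀ (J + I).
  synthesis : (Index → Bool) → Fin (2 * k) → Bool
  synthesis a v = ∑[ i < k ] (a (inj₁ i) ∧ x i v xor a (inj₂ i) ∧ y i v)

  analysis : (Fin (2 * k) → Bool) → Index → Bool
  analysis z c = β (column (swap c)) z

  analysis-cong : ∀ {z z′} → z ≗ z′ → analysis z ≗ analysis z′
  analysis-cong z≗z′ c = β-congʳ (column (swap c)) z≗z′

  synthesis-cong : ∀ {a a′} → a ≗ a′ → synthesis a ≗ synthesis a′
  synthesis-cong a≗a′ v =
    sum-cong-≗ λ i → cong₂ (λ p q → p ∧ x i v xor q ∧ y i v) (a≗a′ (inj₁ i)) (a≗a′ (inj₂ i))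

  synthesis∘analysis : ∀ z → synthesis (analysis z) ≗ z
  synthesis∘analysis z v = begin
    ∑[ i < k ] (β (y i) z ∧ x i v xor β (x i) z ∧ y i v)
      ≡⟨ sum-cong-≗ (λ i → cong₂ (λ p q → p ∧ x i v xor q ∧ y i v) (β≡⟨-,adjK-⟩ (y i) z) (β≡⟨-,adjK-⟩ (x i) z)) ⟩
    ∑[ i < k ] (⟨ y i , w ⟩ ∧ x i v xor ⟨ x i , w ⟩ ∧ y i v)
      ≡⟨ sum-cong-≗ expand ⟩
    ∑[ i < k ] ∑[ u < 2 * k ] ((x i v ∧ y i u xor y i v ∧ x i u) ∧ w u)
      ≡⟨ ∑-comm (λ i u → (x i v ∧ y i u xor y i v ∧ x i u) ∧ w u) ⟩
    ∑[ u < 2 * k ] ∑[ i < k ] ((x i v ∧ y i u xor y i v ∧ x i u) ∧ w u)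
      ≡⟨ sum-cong-≗ (λ u → trans (sym (*-distribʳ-sum (w u) (λ i → x i v ∧ y i u xor y i v ∧ x i u)))
                                 (cong (_∧ w u) (cover v u))) ⟩
    ∑[ u < 2 * k ] (not (does (v ≟ u)) ∧ w u)
      ≡⟨ ∑-offDiagonal v w ⟩
    adjK w v
      ≡⟨ adjK-involutive (oddᵇ-2* k) z v ⟩
    z v
      ∎
    where
    open ≡-Reasoning
    w = adjK z
    expand : ∀ i → ⟨ y i , w ⟩ ∧ x i v xor ⟨ x i , w ⟩ ∧ y i v
                 ≡ ∑[ u < 2 * k ] ((x i v ∧ y i u xor y i v ∧ x i u) ∧ w u)
    expand i = begin
      ⟨ y i , w ⟩ ∧ x i v xor ⟨ x i , w ⟩ ∧ y i v
        ≡⟨ cong₂ _xor_ (*-distribʳ-sum (x i v) (λ u → y i u ∧ w u)) (*-distribʳ-sum (y i v) (λ u → x i u ∧ w u)) ⟩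
      ∑[ u < 2 * k ] ((y i u ∧ w u) ∧ x i v) xor ∑[ u < 2 * k ] ((x i u ∧ w u) ∧ y i v)
        ≡⟨ ∑-distrib-+ (λ u → (y i u ∧ w u) ∧ x i v) (λ u → (x i u ∧ w u) ∧ y i v) ⟨
      ∑[ u < 2 * k ] ((y i u ∧ w u) ∧ x i v xor (x i u ∧ w u) ∧ y i v)
        ≡⟨ sum-cong-≗ (λ u → regroup (y i u) (w u) (x i v) (x i u) (y i v)) ⟩
      ∑[ u < 2 * k ] ((x i v ∧ y i u xor y i v ∧ x i u) ∧ w u)
        ∎
      where
      regroup : ∀ a b c d e → (a ∧ b) ∧ c xor (d ∧ b) ∧ e ≡ (c ∧ a xor e ∧ d) ∧ b
      regroup = solve-∀ 𝔽₂

  analysis-injective : ∀ {z z′} → analysis z ≗ analysis z′ → z ≗ z′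
  analysis-injective {z} {z′} eq v =
    trans (sym (synthesis∘analysis z v)) (trans (synthesis-cong eq v) (synthesis∘analysis z′ v))

  analysis∘synthesis : ∀ a → analysis (synthesis a) ≗ a
  analysis∘synthesis a c =
    let z , z↦a = 𝔽₂-injective⇒surjective (Fin2k↔⊎ k) analysis analysis-injective a
    in trans (analysis-cong (synthesis-cong (sym ∘ z↦a)) c)
      (trans (analysis-cong (synthesis∘analysis z) c) (z↦a c))

  synthesis-unit : ∀ c → synthesis (unit c) ≗ column c
  synthesis-unit (inj₁ j) v =
    trans (sum-cong-≗ (λ i → xor-identityʳ (does (j ≟ i) ∧ x i v))) (∑-δ j (λ i → x i v))
  synthesis-unit (inj₂ j) v = ∑-δ j (λ i → y i v)

  β-columns : ∀ c c′ → β (column (swap c)) (column c′) ≡ unit c′ c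
  β-columns c c′ = trans (analysis-cong (sym ∘ synthesis-unit c′) c) (analysis∘synthesis (unit c′) c)

  synthesis-ones : (∀ c → sum (column c) ≡ true) → ∀ v → ∑[ i < k ] (x i v xor y i v) ≡ true
  synthesis-ones odd v = begin
    synthesis (λ _ → true) v                  ≡⟨ synthesis-cong (sym ∘ analysis-ones) v ⟩
    synthesis (analysis (λ _ → true)) v       ≡⟨ synthesis∘analysis (λ _ → true) v ⟩
    true                                      ∎
    where
    open ≡-Reasoning
    analysis-ones : ∀ c → analysis (λ _ → true) c ≡ true
    analysis-ones c = trans (β-ones (oddᵇ-2* k) (column (swap c))) (odd (swap c))

module OddCoverOfK₂ₖ {k} {X Y : Fin k → Subset (2 * k)} (isOddCover : IsOddCoverOfComplete X Y) where

  private
    x y : Fin k → Fin (2 * k) → Bool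
    x = lookup ∘ X
    y = lookup ∘ Y

    cover : CoverEquation x y
    cover = oddCover⇒coverEquation isOddCover

    disjoint : ∀ i u → x i u ∧ y i u ≡ false
    disjoint i = disjoint-lookup (proj₁ isOddCover i)

  open SymplecticBasis x y cover

  sum-x∧sum-y : ∀ i → sum (x i) ∧ sum (y i) ≡ true
  sum-x∧sum-y i = begin
    sum (x i) ∧ sum (y i)                    ≡⟨ xor-identityʳ _ ⟨
    (sum (x i) ∧ sum (y i)) xor false        ≡⟨ cong ((sum (x i) ∧ sum (y i)) xor_) ⟨x,y⟩≡false ⟨
    β (x i) (y i)                            ≡⟨ β-columns (inj₂ i) (inj₂ i) ⟩
    does (i ≟ i)                             ≡⟨ dec-true (i ≟ i) refl ⟩
    true                                     ∎
    where
    open ≡-Reasoning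
    ⟨x,y⟩≡false : ⟨ x i , y i ⟩ ≡ false
    ⟨x,y⟩≡false = trans (sum-cong-≗ (disjoint i)) (sum-replicate-zero (2 * k))

  sum-column : ∀ c → sum (column c) ≡ true
  sum-column (inj₁ i) = proj₁ (∧≡true (sum-x∧sum-y i))
  sum-column (inj₂ i) = proj₂ (∧≡true (sum-x∧sum-y i))

  ⟨column,column⟩ : ∀ c c′ → ⟨ column (swap c) , column c′ ⟩ ≡ not (unit c′ c)
  ⟨column,column⟩ c c′ =
    trans (⟨⟩≡not-β {a = column (swap c)} {column c′} (sum-column (swap c)) (sum-column c′))
          (cong not (β-columns c c′))

  size-mod4 : ∀ {i} (p : Subset (2 * k)) → oddᵇ ∣ p ∣ ≡ true →
    (∀ j → ⟨ lookup p , x j ⟩ ∧ ⟨ lookup p , y j ⟩ ≡ not (does (j ≟ i))) →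
    (k % 2 ≡ 1 → ∣ p ∣ % 4 ≡ 1) × (k % 2 ≡ 0 → ∣ p ∣ % 4 ≡ 3)
  size-mod4 {i} p odd products = residue ∘ Odd⇒oddᵇ k , residue ∘ %2≡0⇒oddᵇ≡false k
    where
    open ≡-Reasoning
    half : oddᵇ ⌊ ∣ p ∣ /2⌋ ≡ not (oddᵇ k)
    half = begin
      oddᵇ ⌊ ∣ p ∣ /2⌋                                      ≡⟨ pairSum-square p ⟨
      pairSum (λ u v → lookup p u ∧ lookup p v)            ≡⟨ pairSum≡∑products {x = x} {y} cover disjoint (lookup p) ⟩
      ∑[ j < k ] (⟨ lookup p , x j ⟩ ∧ ⟨ lookup p , y j ⟩)  ≡⟨ sum-cong-≗ products ⟩
      ∑[ j < k ] not (does (j ≟ i))                        ≡⟨ ∑-≢ i ⟩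
      not (oddᵇ k)                                         ∎
    residue : ∀ {b} → oddᵇ k ≡ b → ∣ p ∣ % 4 ≡ (if not b then 3 else 1)
    residue refl = trans (oddᵇ⇒%4 ∣ p ∣ odd) (cong (if_then 3 else 1) half)

  sizes-mod4 : ∀ i → (k % 2 ≡ 1 → (∣ X i ∣ % 4 ≡ 1) × (∣ Y i ∣ % 4 ≡ 1)) ×
                     (k % 2 ≡ 0 → (∣ X i ∣ % 4 ≡ 3) × (∣ Y i ∣ % 4 ≡ 3))
  sizes-mod4 i =
    let X≡1 , X≡3 = size-mod4 (X i) (trans (sym (∑-lookup (X i))) (sum-column (inj₁ i)))
                      (λ j → cong₂ _∧_ (⟨column,column⟩ (inj₂ i) (inj₁ j)) (⟨column,column⟩ (inj₂ i) (inj₂ j)))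
        Y≡1 , Y≡3 = size-mod4 (Y i) (trans (sym (∑-lookup (Y i))) (sum-column (inj₂ i)))
                      (λ j → trans (cong₂ _∧_ (⟨column,column⟩ (inj₁ i) (inj₁ j)) (⟨column,column⟩ (inj₁ i) (inj₂ j)))
                                   (∧-identityʳ _))
    in (λ k-odd → X≡1 k-odd , Y≡1 k-odd) , (λ k-even → X≡3 k-even , Y≡3 k-even)

  intersections-odd : ∀ i j → i ≢ j → Odd ∣ X i ∩ X j ∣ × Odd ∣ X i ∩ Y j ∣ × Odd ∣ Y i ∩ Y j ∣
  intersections-odd i j i≢j =
      ⟨⟩≡true⇒Odd∣∩∣ (X i) (X j) (⟨column,column⟩ (inj₂ i) (inj₁ j))
    , ⟨⟩≡true⇒Odd∣∩∣ (X i) (Y j) (trans (⟨column,column⟩ (inj₂ i) (inj₂ j)) (cong not (dec-false (j ≟ i) (i≢j ∘ sym))))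
    , ⟨⟩≡true⇒Odd∣∩∣ (Y i) (Y j) (⟨column,column⟩ (inj₁ i) (inj₂ j))

  membership-odd : ∀ v → Odd ∣ tabulate (λ i → lookup (X i ∪ Y i) v) ∣
  membership-odd v = oddᵇ⇒Odd ∣ memberships ∣ (begin
    oddᵇ ∣ memberships ∣                                   ≡⟨ ∑-lookup memberships ⟨
    sum (lookup memberships)                               ≡⟨ sum-cong-≗ (lookup∘tabulate (λ i → lookup (X i ∪ Y i) v)) ⟩
    ∑[ i < k ] lookup (X i ∪ Y i) v                        ≡⟨ sum-cong-≗ ∪≡xor ⟩
    ∑[ i < k ] (x i v xor y i v)                           ≡⟨ synthesis-ones sum-column v ⟩
    true                                                   ∎)
    where
    open ≡-Reasoning
    memberships = tabulate (λ i → lookup (X i ∪ Y i) v)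
    ∪≡xor : ∀ i → lookup (X i ∪ Y i) v ≡ x i v xor y i v
    ∪≡xor i = trans (lookup-zipWith _∨_ v (X i) (Y i)) (∨≡xor (x i v) (y i v) (disjoint i v))

  odd-transversal : ∀ s → s % 4 ≡ 2 ⊎ s % 4 ≡ 3 → (A : Subset (2 * k)) → ∣ A ∣ ≡ s →
    ∃[ i ] (Odd ∣ A ∩ X i ∣ × Odd ∣ A ∩ Y i ∣)
  odd-transversal _ s%4 A refl =
    let i , products≡true = ∑≡true⇒∃ _ ∑products≡true
        odd-x , odd-y = ∧≡true products≡true
    in i , ⟨⟩≡true⇒Odd∣∩∣ A (X i) odd-x , ⟨⟩≡true⇒Odd∣∩∣ A (Y i) odd-y
    where
    open ≡-Reasoning
    ∑products≡true : ∑[ i < k ] (⟨ lookup A , x i ⟩ ∧ ⟨ lookup A , y i ⟩) ≡ true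
    ∑products≡true = begin
      ∑[ i < k ] (⟨ lookup A , x i ⟩ ∧ ⟨ lookup A , y i ⟩)   ≡⟨ pairSum≡∑products {x = x} {y} cover disjoint (lookup A) ⟨
      pairSum (λ u v → lookup A u ∧ lookup A v)             ≡⟨ pairSum-square A ⟩
      oddᵇ ⌊ ∣ A ∣ /2⌋                                       ≡⟨ %4≡2∨3⇒oddᵇ⌊/2⌋ ∣ A ∣ s%4 ⟩
      true                                                  ∎

theorem22 : (k : ℕ) → 1 ≤ k → (X Y : Fin k → Subset (2 * k)) →
    IsOddCoverOfComplete X Y →
    (((i : Fin k) →
        (k % 2 ≡ 1 → (∣ X i ∣ % 4 ≡ 1) × (∣ Y i ∣ % 4 ≡ 1)) ×
        (k % 2 ≡ 0 → (∣ X i ∣ % 4 ≡ 3) × (∣ Y i ∣ % 4 ≡ 3)))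
    × ((i j : Fin k) → i ≢ j →
        Odd ∣ X i ∩ X j ∣ × Odd ∣ X i ∩ Y j ∣ × Odd ∣ Y i ∩ Y j ∣)
    × ((v : Fin (2 * k)) → Odd ∣ tabulate (λ i → lookup (X i ∪ Y i) v) ∣)
    × ((s : ℕ) → (s % 4 ≡ 2 ⊎ s % 4 ≡ 3) → (A : Subset (2 * k)) → ∣ A ∣ ≡ s →
        ∃[ i ] (Odd ∣ A ∩ X i ∣ × Odd ∣ A ∩ Y i ∣)))
theorem22 k _ X Y isOddCover = sizes-mod4 , intersections-odd , membership-odd , odd-transversal
  where open OddCoverOfK₂ₖ isOddCover
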